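{- Let $n$ be a positive integer and let $a,b$ be integers with $0<a<b$, regarded as elements of $\mathbb{Z}_n$. Suppose the 12 elements $$0,\ a,\ b,\ 2b,\ b+a,\ b-a,\ 2b-a,\ 2b-2a,\ 3b-a,\ 3b-2a,\ 2b+a,\ 3b$$ are pairwise distinct in $\mathbb{Z}_n$. Suppose also that the 12 elements $$0,\ a,\ b,\ 2b,\ b+a,\ b-a,\ 2b-a,\ 2b-2a,\ 3b-a,\ 3b-2a,\ -a,\ b-2a$$ are pairwise distinct in $\mathbb{Z}_n$. Then the cyclic Haar graph $H(n,\{0,a,b\})$ has girth exactly 6.
   Context: For a positive integer $n$ and $S\subseteq\mathbb{Z}_n$, the cyclic Haar graph $H(n,S)$ has vertex set $\{i^+: i\in\mathbb{Z}_n\}\cup\{i^-: i\in\mathbb{Z}_n\}$. Its edges join $i^+$ to $(i+k)^-$ for each $i\in\mathbb{Z}_n$ and each $k\in S$. -}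

module Defs where

open import Data.Nat using (ℕ; zero; suc)
open import Data.Integer using (ℤ; +_; _-_; _+_; -_; _*_)
open import Data.Integer.Divisibility using (_∣_)
open import Data.Fin using (Fin; toℕ; inject₁; fromℕ) renaming (zero to fzero; suc to fsuc)
open import Data.Bool using (Bool; true; false)
open import Data.Product using (_×_; Σ; ∃; _,_)
open import Data.Sum using (_⊎_)
open import Data.Empty using (⊥)
open import Data.List using (List)
open import Data.List.Membership.Propositional using (_∈_)
open import Data.List.Relation.Unary.AllPairs using (AllPairs)
open import Relation.Nullary using (¬_)
open import Relation.Binary.PropositionalEquality using (_≡_)
open import Function.Definitions using (Injective)

_≡[mod_]_ : ℤ → ℕ → ℤ → Set
x ≡[mod n ] y = (+ n) ∣ (x - y)

DistinctMod : ℕ → List ℤ → Set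
DistinctMod n xs = AllPairs (λ x y → ¬ (x ≡[mod n ] y)) xs

-- vertices of H(n,S): (i , true) is i⁺ and (i , false) is i⁻
Vertex : ℕ → Set
Vertex n = Fin n × Bool

PlusMinus : (n : ℕ) → List ℤ → Fin n → Fin n → Set
PlusMinus n S i j = Σ ℤ λ k → (k ∈ S) × ((+ toℕ j) ≡[mod n ] ((+ toℕ i) + k))

HaarAdj : (n : ℕ) → List ℤ → Vertex n → Vertex n → Set
HaarAdj n S (i , true)  (j , false) = PlusMinus n S i j
HaarAdj n S (i , false) (j , true)  = PlusMinus n S j i
HaarAdj n S (_ , true)  (_ , true)  = ⊥
HaarAdj n S (_ , false) (_ , false) = ⊥

-- a cycle of length (suc m) in a graph with vertex set V and adjacency Adj:
-- pairwise distinct vertices c 0, …, c m with c i ~ c (i+1) and c m ~ c 0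
-- (length ≥ 3 is imposed separately where used)
record Cycle {V : Set} (Adj : V → V → Set) (m : ℕ) : Set where
  field
    vert  : Fin (suc m) → V
    inj   : Injective _≡_ _≡_ vert
    step  : (i : Fin m) → Adj (vert (inject₁ i)) (vert (fsuc i))
    close : Adj (vert (fromℕ m)) (vert fzero)

HasCycleOfLength : {V : Set} → (V → V → Set) → ℕ → Set
HasCycleOfLength Adj zero = ⊥
HasCycleOfLength Adj (suc m) = Cycle Adj m

Girth≡ : {V : Set} → (V → V → Set) → ℕ → Set
Girth≡ {V} Adj g =
  HasCycleOfLength Adj g ×
  ((k : ℕ) → 3 Data.Nat.≤ k → k Data.Nat.< g → ¬ HasCycleOfLength Adj k)

module Submission where

-- H(n, S) is bipartite (every edge joins some i⁺ to some j⁻), so it has no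
-- cycle of length 3 or 5.  A 4-cycle i⁺ j⁻ k⁺ l⁻ with edge labels
-- s₁ s₂ s₃ s₄ ∈ S (j = i + s₁ = k + s₂, l = k + s₃ = i + s₄ in ℤ_n) forces
-- s₁ + s₃ = s₂ + s₄; when S is a Sidon set this relation is trivial, and
-- each trivial solution identifies two opposite vertices.  A three-element
-- set {x, y, z} is Sidon once no element is a midpoint of two elements
-- (doubles included), since among four indices in a three-element set two
-- coincide.  For pairwise incongruent x, y, z the walk
-- 0⁺ x⁻ (x-y)⁺ (x-y+z)⁻ (z-y)⁺ z⁻ is a 6-cycle.

open import Defs
open import Data.Nat using (ℕ; _<_)
open import Data.Integer using (ℤ; +_; _-_; _+_; -_; _*_)
open import Data.List using (List; _∷_; [])

import Data.Nat as ℕ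
import Data.Nat.Properties as ℕ
import Data.Nat.Divisibility as ℕ
open import Data.Nat using (NonZero; z<s; s<s; s≤s; >-nonZero)
open import Data.Integer using (∣_∣)
open import Data.Integer.Properties
  using (m-n≡m⊖n; ∣m⊝n∣≤m⊔n; ∣i∣≡0⇒i≡0; i-j≡0⇒i≡j; +-injective; +-inverseʳ; +-comm)
open import Data.Integer.Divisibility using (_∣_)
import Data.Integer.Divisibility.Signed as Signed
open import Data.Integer.DivMod using (_%ℕ_; _/ℕ_; n%ℕd<d; a≡a%ℕn+[a/ℕn]*n)
open import Data.Integer.Tactic.RingSolver using (solve)
open import Data.Fin using (Fin; toℕ; fromℕ<; _≟_; #_)
import Data.Fin as Fin
open import Data.Fin.Patterns using (0F; 1F; 2F; 3F; 4F; 6F; 7F)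
open import Data.Fin.Properties using (toℕ-injective; toℕ<n; toℕ-fromℕ<; all?)
open import Data.Bool using (Bool; true; false; not)
open import Data.Bool.Properties using (not-involutive; not-¬)
open import Data.Product using (_,_; proj₁; proj₂)
open import Data.Sum using (_⊎_; inj₁; inj₂)
import Data.Sum as Sum
open import Data.Empty using (⊥; ⊥-elim)
open import Data.List using (lookup; length)
open import Data.List.Membership.Propositional using (_∈_)
open import Data.List.Membership.Propositional.Properties using (∈-lookup)
open import Data.List.Relation.Unary.Any using (index; here; there)
open import Data.List.Relation.Unary.Any.Properties using (lookup-index)
import Data.List.Relation.Unary.All as All
open import Data.List.Relation.Unary.AllPairs as AllPairs using (AllPairs)
open import Data.Vec using (Vec)
import Data.Vec as Vec
import Data.Vec.Relation.Unary.All as VecAll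
import Data.Vec.Relation.Unary.AllPairs as VecAllPairs
open import Data.Vec.Relation.Unary.Unique.Propositional using (Unique)
open import Data.Vec.Relation.Unary.Unique.Propositional.Properties using (lookup-injective)
open import Level using (0ℓ)
open import Relation.Nullary using (¬_; Dec; contradiction)
open import Function using (case_of_)
open import Relation.Nullary.Decidable using (from-yes; _⊎-dec_)
open import Relation.Binary.Bundles using (Setoid)
open import Relation.Binary.PropositionalEquality
  using (_≡_; _≢_; refl; sym; trans; cong; subst)

allPairs-lookup : ∀ {A : Set} {R : A → A → Set} {xs : List A} → AllPairs R xs →
                  (i j : Fin (length xs)) → i Fin.< j → R (lookup xs i) (lookup xs j)
allPairs-lookup (Rx AllPairs.∷ _)    0F          (Fin.suc j) _         = All.lookup Rx (∈-lookup j)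
allPairs-lookup (_ AllPairs.∷ pairs) (Fin.suc i) (Fin.suc j) (s<s i<j) = allPairs-lookup pairs i j i<j

-- Pigeonhole for four indices in a three-element set: one of the six
-- pairs below coincides.  (The pairs are those met in the Sidon argument.)
Coincidence : (t₁ t₂ t₃ t₄ : Fin 3) → Set
Coincidence t₁ t₂ t₃ t₄ = t₁ ≡ t₂ ⊎ t₁ ≡ t₄ ⊎ t₃ ≡ t₂ ⊎ t₃ ≡ t₄ ⊎ t₁ ≡ t₃ ⊎ t₂ ≡ t₄

coincidence? : ∀ t₁ t₂ t₃ t₄ → Dec (Coincidence t₁ t₂ t₃ t₄)
coincidence? t₁ t₂ t₃ t₄ =
  (t₁ ≟ t₂) ⊎-dec (t₁ ≟ t₄) ⊎-dec (t₃ ≟ t₂) ⊎-dec (t₃ ≟ t₄) ⊎-dec (t₁ ≟ t₃) ⊎-dec (t₂ ≟ t₄)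

coincidence : ∀ t₁ t₂ t₃ t₄ → Coincidence t₁ t₂ t₃ t₄
coincidence = from-yes (all? λ t₁ → all? λ t₂ → all? λ t₃ → all? (coincidence? t₁ t₂ t₃))

module Bipartite {V : Set} (Adj : V → V → Set) (side : V → Bool)
                 (side-flips : ∀ {u v} → Adj u v → side v ≡ not (side u)) where

  two-steps : ∀ {u v w} → Adj u v → Adj v w → side w ≡ side u
  two-steps {u} u~v v~w = trans (side-flips v~w) (trans (cong not (side-flips u~v)) (not-involutive (side u)))

  no-triangle : ¬ Cycle Adj 2
  no-triangle c = not-¬ refl (trans (side-flips close) (cong not (two-steps (step 0F) (step 1F))))
    where open Cycle c

  no-pentagon : ¬ Cycle Adj 4
  no-pentagon c = not-¬ refl
    (trans (side-flips close) (cong not (trans (two-steps (step 2F) (step 3F)) (two-steps (step 0F) (step 1F)))))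
    where open Cycle c

module Modulo (n : ℕ) where

  -- Congruence modulo n, packaged as a record so that both sides can be
  -- recovered by unification (the underlying divisibility of a
  -- difference does not determine them).
  infix 4 _≋_
  record _≋_ (x y : ℤ) : Set where
    constructor mod
    field unmod : x ≡[mod n ] y
  open _≋_ public

  private
    toSigned : ∀ {x y} → x ≋ y → (+ n) Signed.∣ (x - y)
    toSigned (mod x≡y) = Signed.∣ᵤ⇒∣ x≡y

    fromSigned : ∀ {x y} → (+ n) Signed.∣ (x - y) → x ≋ y
    fromSigned n∣x-y = mod (Signed.∣⇒∣ᵤ n∣x-y)

  ≋-by-difference : ∀ {x y x′ y′} → x ≋ y → x - y ≡ x′ - y′ → x′ ≋ y′
  ≋-by-difference (mod x≡y) eq = mod (subst ((+ n) ∣_) eq x≡y)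

  ≉-by-difference : ∀ {x y x′ y′} → ¬ x ≋ y → x - y ≡ x′ - y′ → ¬ x′ ≋ y′
  ≉-by-difference x≉y eq x′≋y′ = x≉y (≋-by-difference x′≋y′ (sym eq))

  ≋-refl : ∀ {x} → x ≋ x
  ≋-refl {x} = mod (subst ((+ n) ∣_) (sym (+-inverseʳ x)) (n ℕ.∣0))

  ≋-reflexive : ∀ {x y} → x ≡ y → x ≋ y
  ≋-reflexive refl = ≋-refl

  ≋-sym : ∀ {x y} → x ≋ y → y ≋ x
  ≋-sym {x} {y} x≋y = fromSigned (subst ((+ n) Signed.∣_) negate (Signed.∣m⇒∣-m (toSigned x≋y)))
    where
    negate : - (x - y) ≡ y - x
    negate = solve (x ∷ y ∷ [])

  ≉-sym : ∀ {x y} → ¬ x ≋ y → ¬ y ≋ x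
  ≉-sym x≉y y≋x = x≉y (≋-sym y≋x)

  ≋-trans : ∀ {x y z} → x ≋ y → y ≋ z → x ≋ z
  ≋-trans {x} {y} {z} x≋y y≋z =
    fromSigned (subst ((+ n) Signed.∣_) telescope (Signed.∣m∣n⇒∣m+n (toSigned x≋y) (toSigned y≋z)))
    where
    telescope : (x - y) + (y - z) ≡ x - z
    telescope = solve (x ∷ y ∷ z ∷ [])

  ≋-+ : ∀ {x x′ y y′} → x ≋ x′ → y ≋ y′ → (x + y) ≋ (x′ + y′)
  ≋-+ {x} {x′} {y} {y′} x≋x′ y≋y′ =
    fromSigned (subst ((+ n) Signed.∣_) regroup (Signed.∣m∣n⇒∣m+n (toSigned x≋x′) (toSigned y≋y′)))
    where
    regroup : (x - x′) + (y - y′) ≡ (x + y) - (x′ + y′)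
    regroup = solve (x ∷ x′ ∷ y ∷ y′ ∷ [])

  ≋-cancelʳ : ∀ {x y} c → (x + c) ≋ (y + c) → x ≋ y
  ≋-cancelʳ {x} {y} c x+c≋y+c = ≋-by-difference x+c≋y+c (solve (x ∷ y ∷ c ∷ []))

  ≋-setoid : Setoid 0ℓ 0ℓ
  ≋-setoid = record
    { Carrier = ℤ
    ; _≈_ = _≋_
    ; isEquivalence = record { refl = ≋-refl ; sym = ≋-sym ; trans = ≋-trans }
    }

  open import Relation.Binary.Reasoning.Setoid ≋-setoid public
    using (begin_; _∎; step-≈-⟩; step-≈-⟨; step-≡-⟩; step-≡-∣)

  -- The labels 0, …, n-1 are pairwise incongruent, so Fin n is a faithful
  -- copy of ℤ_n: the distance of two labels is a multiple of n below n.
  residue-injective : (i j : Fin n) → (+ toℕ i) ≋ (+ toℕ j) → i ≡ j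
  residue-injective i j (mod n∣distance) =
    toℕ-injective (+-injective (i-j≡0⇒i≡j _ _ (∣i∣≡0⇒i≡0 (small-multiple _ n∣distance distance<n))))
    where
    small-multiple : (d : ℕ) → n ℕ.∣ d → d < n → d ≡ 0
    small-multiple ℕ.zero    _   _   = refl
    small-multiple (ℕ.suc d) n∣d d<n = contradiction n∣d (ℕ.>⇒∤ d<n)

    distance<n : ∣ + toℕ i - + toℕ j ∣ < n
    distance<n rewrite m-n≡m⊖n (toℕ i) (toℕ j) =
      ℕ.≤-<-trans (∣m⊝n∣≤m⊔n (toℕ i) (toℕ j)) (ℕ.⊔-pres-<m (toℕ<n i) (toℕ<n j))

  module _ {{_ : NonZero n}} where

    residue : ℤ → Fin n
    residue x = fromℕ< (n%ℕd<d x n)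

    residue-≋ : ∀ x → (+ toℕ (residue x)) ≋ x
    residue-≋ x rewrite toℕ-fromℕ< (n%ℕd<d x n) =
      fromSigned (Signed.divides (- (x /ℕ n)) (trans (cong (λ w → + (x %ℕ n) - w) (a≡a%ℕn+[a/ℕn]*n x n))
                                          (remainder (+ (x %ℕ n)) (x /ℕ n) (+ n))))
      where
      remainder : ∀ r q m → r - (r + q * m) ≡ - q * m
      remainder r q m = solve (r ∷ q ∷ m ∷ [])

    residue-≡⇒≋ : ∀ {x y} → residue x ≡ residue y → x ≋ y
    residue-≡⇒≋ {x} {y} same = begin
      x                    ≈⟨ residue-≋ x ⟨
      + toℕ (residue x)    ≡⟨ cong (λ i → + toℕ i) same ⟩
      + toℕ (residue y)    ≈⟨ residue-≋ y ⟩
      y                    ∎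

  Sidon : List ℤ → Set
  Sidon S = ∀ {s₁ s₂ s₃ s₄} → s₁ ∈ S → s₂ ∈ S → s₃ ∈ S → s₄ ∈ S →
            (s₁ + s₃) ≋ (s₂ + s₄) → s₁ ≋ s₂ ⊎ s₁ ≋ s₄

  Sidon-by-position : (S : List ℤ) →
    (∀ t₁ t₂ t₃ t₄ → let s = lookup S in
       (s t₁ + s t₃) ≋ (s t₂ + s t₄) → s t₁ ≋ s t₂ ⊎ s t₁ ≋ s t₄) →
    Sidon S
  Sidon-by-position S by-position p₁ p₂ p₃ p₄
    rewrite lookup-index p₁ | lookup-index p₂ | lookup-index p₃ | lookup-index p₄ =
    by-position (index p₁) (index p₂) (index p₃) (index p₄)

  MidpointFree : (Fin 3 → ℤ) → Set
  MidpointFree v = ∀ p q r → (v p + v q) ≋ (v r + v r) → v p ≋ v r ⊎ v q ≋ v r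

  -- A midpoint-free three-term family is Sidon: in a relation
  -- v t₁ + v t₃ = v t₂ + v t₄ two indices coincide, and each coincidence
  -- either makes the relation trivial or exhibits a midpoint.
  midpoint-free⇒Sidon : ∀ {x y z} → MidpointFree (lookup (x ∷ y ∷ z ∷ [])) → Sidon (x ∷ y ∷ z ∷ [])
  midpoint-free⇒Sidon {x} {y} {z} free = Sidon-by-position (x ∷ y ∷ z ∷ []) relation
    where
    v : Fin 3 → ℤ
    v = lookup (x ∷ y ∷ z ∷ [])

    relation : ∀ t₁ t₂ t₃ t₄ → (v t₁ + v t₃) ≋ (v t₂ + v t₄) → v t₁ ≋ v t₂ ⊎ v t₁ ≋ v t₄
    relation t₁ t₂ t₃ t₄ rel with coincidence t₁ t₂ t₃ t₄
    ... | inj₁ refl                          = inj₁ ≋-refl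
    ... | inj₂ (inj₁ refl)                   = inj₂ ≋-refl
    ... | inj₂ (inj₂ (inj₁ refl))            = inj₂ (≋-cancelʳ _ (≋-trans rel (≋-reflexive (+-comm (v t₃) (v t₄)))))
    ... | inj₂ (inj₂ (inj₂ (inj₁ refl)))     = inj₁ (≋-cancelʳ _ rel)
    ... | inj₂ (inj₂ (inj₂ (inj₂ (inj₁ refl)))) = Sum.map ≋-sym ≋-sym (free t₂ t₄ t₁ (≋-sym rel))
    ... | inj₂ (inj₂ (inj₂ (inj₂ (inj₂ refl)))) with free t₁ t₃ t₂ rel
    ...   | inj₁ v₁≋v₂ = inj₁ v₁≋v₂
    ...   | inj₂ v₃≋v₂ = inj₁ (≋-cancelʳ _ (≋-trans rel (≋-+ (≋-refl {v t₂}) (≋-sym v₃≋v₂))))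

  midpoint-free-three : ∀ {x y z} →
    ¬ (x + x) ≋ (y + y) → ¬ (x + x) ≋ (z + z) → ¬ (y + y) ≋ (z + z) →
    ¬ (x + x) ≋ (y + z) → ¬ (y + y) ≋ (x + z) → ¬ (z + z) ≋ (x + y) →
    MidpointFree (lookup (x ∷ y ∷ z ∷ []))
  midpoint-free-three {x} {y} {z} 2x≉2y 2x≉2z 2y≉2z 2x≉y+z 2y≉x+z 2z≉x+y = free
    where
    swap : ∀ u w {c} → (u + w) ≋ c → (w + u) ≋ c
    swap u w = ≋-trans (≋-reflexive (+-comm w u))

    free : MidpointFree (lookup (x ∷ y ∷ z ∷ []))
    free 0F _  0F _ = inj₁ ≋-refl
    free 1F _  1F _ = inj₁ ≋-refl
    free 2F _  2F _ = inj₁ ≋-refl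
    free _  0F 0F _ = inj₂ ≋-refl
    free _  1F 1F _ = inj₂ ≋-refl
    free _  2F 2F _ = inj₂ ≋-refl
    free 1F 1F 0F e = ⊥-elim (2x≉2y (≋-sym e))
    free 1F 2F 0F e = ⊥-elim (2x≉y+z (≋-sym e))
    free 2F 1F 0F e = ⊥-elim (2x≉y+z (≋-sym (swap z y e)))
    free 2F 2F 0F e = ⊥-elim (2x≉2z (≋-sym e))
    free 0F 0F 1F e = ⊥-elim (2x≉2y e)
    free 0F 2F 1F e = ⊥-elim (2y≉x+z (≋-sym e))
    free 2F 0F 1F e = ⊥-elim (2y≉x+z (≋-sym (swap z x e)))
    free 2F 2F 1F e = ⊥-elim (2y≉2z (≋-sym e))
    free 0F 0F 2F e = ⊥-elim (2x≉2z e)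
    free 0F 1F 2F e = ⊥-elim (2z≉x+y (≋-sym e))
    free 1F 0F 2F e = ⊥-elim (2z≉x+y (≋-sym (swap y x e)))
    free 1F 1F 2F e = ⊥-elim (2y≉2z e)

  -- The Sidon property of {0, a, b}, from six incongruences in the shape in
  -- which the hypotheses of the corollary provide them.
  Sidon-0ab : ∀ {a b} →
    ¬ a ≋ (- a) → ¬ (+ 0) ≋ ((+ 2) * b) → ¬ (+ 0) ≋ (((+ 2) * b) - ((+ 2) * a)) →
    ¬ (+ 0) ≋ (b + a) → ¬ (+ 0) ≋ (b - ((+ 2) * a)) → ¬ (+ 0) ≋ (((+ 2) * b) - a) →
    Sidon ((+ 0) ∷ a ∷ b ∷ [])
  Sidon-0ab {a} {b} a≉-a 0≉2b 0≉2b-2a 0≉b+a 0≉b-2a 0≉2b-a =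
    midpoint-free⇒Sidon (midpoint-free-three
      (≉-sym (≉-by-difference a≉-a ≡2a)) (≉-by-difference 0≉2b ≡-2b) (≉-by-difference 0≉2b-2a ≡2a-2b)
      (≉-by-difference 0≉b+a ≡-a-b) (≉-by-difference 0≉b-2a ≡2a-b) (≉-sym (≉-by-difference 0≉2b-a ≡a-2b)))
    where
    -- each hypothesis, rewritten as a difference of two pair sums
    -- (the sum 0 + 0 computes to 0)
    ≡2a    : a - (- a) ≡ (a + a) - (+ 0)
    ≡2a    = solve (a ∷ [])
    ≡-2b   : (+ 0) - ((+ 2) * b) ≡ (+ 0) - (b + b)
    ≡-2b   = solve (b ∷ [])
    ≡2a-2b : (+ 0) - (((+ 2) * b) - ((+ 2) * a)) ≡ (a + a) - (b + b)
    ≡2a-2b = solve (a ∷ b ∷ [])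
    ≡-a-b  : (+ 0) - (b + a) ≡ (+ 0) - (a + b)
    ≡-a-b  = solve (a ∷ b ∷ [])
    ≡2a-b  : (+ 0) - (b - ((+ 2) * a)) ≡ (a + a) - ((+ 0) + b)
    ≡2a-b  = solve (a ∷ b ∷ [])
    ≡a-2b  : (+ 0) - (((+ 2) * b) - a) ≡ ((+ 0) + a) - (b + b)
    ≡a-2b  = solve (a ∷ b ∷ [])

  entries-apart : ∀ {xs} → DistinctMod n xs → (i j : Fin (length xs)) → i Fin.< j →
          ¬ lookup xs i ≋ lookup xs j
  entries-apart distinct i j i<j (mod i≡j) = allPairs-lookup distinct i j i<j i≡j

module HaarGraph (n : ℕ) where
  open Modulo n

  ⟦_⟧ : Fin n → ℤ
  ⟦ i ⟧ = + toℕ i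

  side-flips : ∀ {S u v} → HaarAdj n S u v → proj₂ v ≡ not (proj₂ u)
  side-flips {u = _ , true}  {v = _ , false} _ = refl
  side-flips {u = _ , false} {v = _ , true}  _ = refl
  side-flips {u = _ , true}  {v = _ , true}  ()
  side-flips {u = _ , false} {v = _ , false} ()

  -- The four edges i⁺j⁻, k⁺j⁻, k⁺l⁻, i⁺l⁻ of a closed walk force, over a
  -- Sidon set, i = k or j = l: their labels satisfy s₁ + s₃ = s₂ + s₄.
  rectangle : ∀ {S i j k l} → Sidon S →
    PlusMinus n S i j → PlusMinus n S k j → PlusMinus n S k l → PlusMinus n S i l → i ≡ k ⊎ j ≡ l
  rectangle {i = i} {j} {k} {l} sidon (s₁ , s₁∈S , j-i) (s₂ , s₂∈S , j-k) (s₃ , s₃∈S , l-k) (s₄ , s₄∈S , l-i) =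
    Sum.map same-start same-end (sidon s₁∈S s₂∈S s₃∈S s₄∈S balanced)
    where
    gather : ∀ p q r t → (p + q) + (r + t) ≡ (r + p) + (t + q)
    gather p q r t = solve (p ∷ q ∷ r ∷ t ∷ [])

    scatter : ∀ p q r t → (r + p) + (t + q) ≡ (p + q) + (t + r)
    scatter p q r t = solve (p ∷ q ∷ r ∷ t ∷ [])

    j≋i+s₁ : ⟦ j ⟧ ≋ (⟦ i ⟧ + s₁)
    j≋i+s₁ = mod j-i
    j≋k+s₂ : ⟦ j ⟧ ≋ (⟦ k ⟧ + s₂)
    j≋k+s₂ = mod j-k
    l≋k+s₃ : ⟦ l ⟧ ≋ (⟦ k ⟧ + s₃)
    l≋k+s₃ = mod l-k
    l≋i+s₄ : ⟦ l ⟧ ≋ (⟦ i ⟧ + s₄)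
    l≋i+s₄ = mod l-i

    balanced : (s₁ + s₃) ≋ (s₂ + s₄)
    balanced = ≋-cancelʳ (⟦ i ⟧ + ⟦ k ⟧) (begin
      (s₁ + s₃) + (⟦ i ⟧ + ⟦ k ⟧)     ≡⟨ gather s₁ s₃ ⟦ i ⟧ ⟦ k ⟧ ⟩
      (⟦ i ⟧ + s₁) + (⟦ k ⟧ + s₃)     ≈⟨ ≋-+ j≋i+s₁ l≋k+s₃ ⟨
      ⟦ j ⟧ + ⟦ l ⟧                   ≈⟨ ≋-+ j≋k+s₂ l≋i+s₄ ⟩
      (⟦ k ⟧ + s₂) + (⟦ i ⟧ + s₄)     ≡⟨ scatter s₂ s₄ ⟦ k ⟧ ⟦ i ⟧ ⟩
      (s₂ + s₄) + (⟦ i ⟧ + ⟦ k ⟧)     ∎)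

    same-start : s₁ ≋ s₂ → i ≡ k
    same-start s₁≋s₂ = residue-injective i k (≋-cancelʳ s₁ (begin
      ⟦ i ⟧ + s₁   ≈⟨ j≋i+s₁ ⟨
      ⟦ j ⟧        ≈⟨ j≋k+s₂ ⟩
      ⟦ k ⟧ + s₂   ≈⟨ ≋-+ (≋-refl {⟦ k ⟧}) s₁≋s₂ ⟨
      ⟦ k ⟧ + s₁   ∎))

    same-end : s₁ ≋ s₄ → j ≡ l
    same-end s₁≋s₄ = residue-injective j l (begin
      ⟦ j ⟧        ≈⟨ j≋i+s₁ ⟩
      ⟦ i ⟧ + s₁   ≈⟨ ≋-+ (≋-refl {⟦ i ⟧}) s₁≋s₄ ⟩
      ⟦ i ⟧ + s₄   ≈⟨ l≋i+s₄ ⟨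
      ⟦ l ⟧        ∎)

  private
    collapse : ∀ {i j k l : Fin n} → i ≡ k ⊎ j ≡ l →
               _≢_ {A = Vertex n} (i , true) (k , true) → _≢_ {A = Vertex n} (j , false) (l , false) → ⊥
    collapse (inj₁ refl) i≢k _   = i≢k refl
    collapse (inj₂ refl) _   j≢l = j≢l refl

  -- A closed walk of length 4 alternates sides, so its edges form a
  -- rectangle as above; over a Sidon set two opposite vertices coincide.
  no-square : ∀ {S} → Sidon S → (u₀ u₁ u₂ u₃ : Vertex n) →
    HaarAdj n S u₀ u₁ → HaarAdj n S u₁ u₂ → HaarAdj n S u₂ u₃ → HaarAdj n S u₃ u₀ →
    u₀ ≢ u₂ → u₁ ≢ u₃ → ⊥
  no-square sidon (i , true) (j , false) (k , true) (l , false) ij kj kl il i≢k j≢l =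
    collapse (rectangle sidon ij kj kl il) i≢k j≢l
  no-square sidon (j , false) (i , true) (l , false) (k , true) ij il kl kj j≢l i≢k =
    collapse (rectangle sidon ij kj kl il) i≢k j≢l
  no-square _ (_ , true)  (_ , true)  _           _           () _  _  _ _ _
  no-square _ (_ , false) (_ , false) _           _           () _  _  _ _ _
  no-square _ (_ , true)  (_ , false) (_ , false) _           _  () _  _ _ _
  no-square _ (_ , false) (_ , true)  (_ , true)  _           _  () _  _ _ _
  no-square _ (_ , true)  (_ , false) (_ , true)  (_ , true)  _  _  () _ _ _
  no-square _ (_ , false) (_ , true)  (_ , false) (_ , false) _  _  () _ _ _

  no-short-cycles : ∀ {S} → Sidon S → ∀ k → 3 ℕ.≤ k → k < 6 → ¬ HasCycleOfLength (HaarAdj n S) k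
  no-short-cycles {S} _ 3 _ _ = Bipartite.no-triangle (HaarAdj n S) proj₂ side-flips
  no-short-cycles {S} _ 5 _ _ = Bipartite.no-pentagon (HaarAdj n S) proj₂ side-flips
  no-short-cycles sidon 4 _ _ c =
    no-square sidon _ _ _ _ (step 0F) (step 1F) (step 2F) close
      (λ u₀≡u₂ → case inj u₀≡u₂ of λ ()) (λ u₁≡u₃ → case inj u₁≡u₃ of λ ())
    where open Cycle c
  no-short-cycles _ 0 () _
  no-short-cycles _ 1 (s≤s ()) _
  no-short-cycles _ 2 (s≤s (s≤s ())) _
  no-short-cycles _ (ℕ.suc (ℕ.suc (ℕ.suc (ℕ.suc (ℕ.suc (ℕ.suc _)))))) _ (s≤s (s≤s (s≤s (s≤s (s≤s (s≤s ()))))))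

  module _ {{_ : NonZero n}} where

    edge : ∀ {S s} x y → s ∈ S → y ≋ (x + s) → PlusMinus n S (residue x) (residue y)
    edge {s = s} x y s∈S y≋x+s = s , s∈S , unmod (begin
      ⟦ residue y ⟧         ≈⟨ residue-≋ y ⟩
      y                     ≈⟨ y≋x+s ⟩
      x + s                 ≈⟨ ≋-+ (residue-≋ x) (≋-refl {s}) ⟨
      ⟦ residue x ⟧ + s     ∎)

    apart : ∀ {x y b} → ¬ x ≋ y → _≢_ {A = Vertex n} (residue x , b) (residue y , b)
    apart {x} {y} x≉y same = x≉y (residue-≡⇒≋ {x} {y} (cong proj₁ same))

    hexagon : ∀ {x y z} → ¬ x ≋ y → ¬ x ≋ z → ¬ y ≋ z →
              HasCycleOfLength (HaarAdj n (x ∷ y ∷ z ∷ [])) 6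
    hexagon {x} {y} {z} x≉y x≉z y≉z = record
      { vert  = Vec.lookup corners
      ; inj   = λ {i} {j} → lookup-injective distinct i j
      ; step  = walk
      ; close = edge (+ 0) z z∈ (≋-reflexive (solve (z ∷ [])))
      }
      where
      corners : Vec (Vertex n) 6
      corners = Vec.fromList
        ( (residue (+ 0) , true) ∷ (residue x , false) ∷ (residue (x - y) , true)
        ∷ (residue (x - y + z) , false) ∷ (residue (z - y) , true) ∷ (residue z , false) ∷ [])

      x∈ : x ∈ x ∷ y ∷ z ∷ []
      x∈ = here refl
      y∈ : y ∈ x ∷ y ∷ z ∷ []
      y∈ = there (here refl)
      z∈ : z ∈ x ∷ y ∷ z ∷ []
      z∈ = there (there (here refl))

      walk : (i : Fin 5) → HaarAdj n (x ∷ y ∷ z ∷ []) (Vec.lookup corners (Fin.inject₁ i)) (Vec.lookup corners (Fin.suc i))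
      walk 0F = edge (+ 0) x x∈ (≋-reflexive (solve (x ∷ [])))
      walk 1F = edge (x - y) x y∈ (≋-reflexive (solve (x ∷ y ∷ [])))
      walk 2F = edge (x - y) (x - y + z) z∈ ≋-refl
      walk 3F = edge (z - y) (x - y + z) x∈ (≋-reflexive (solve (x ∷ y ∷ z ∷ [])))
      walk 4F = edge (z - y) z y∈ (≋-reflexive (solve (y ∷ z ∷ [])))

      -- the corners on each side differ by x - y, x - z or y - z
      0≉x-y : ¬ (+ 0) ≋ (x - y)
      0≉x-y = ≉-by-difference (≉-sym x≉y) difference
        where difference : y - x ≡ (+ 0) - (x - y)
              difference = solve (x ∷ y ∷ [])
      0≉z-y : ¬ (+ 0) ≋ (z - y)
      0≉z-y = ≉-by-difference y≉z difference
        where difference : y - z ≡ (+ 0) - (z - y)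
              difference = solve (y ∷ z ∷ [])
      x-y≉z-y : ¬ (x - y) ≋ (z - y)
      x-y≉z-y = ≉-by-difference x≉z difference
        where difference : x - z ≡ (x - y) - (z - y)
              difference = solve (x ∷ y ∷ z ∷ [])
      x≉x-y+z : ¬ x ≋ (x - y + z)
      x≉x-y+z = ≉-by-difference y≉z difference
        where difference : y - z ≡ x - (x - y + z)
              difference = solve (x ∷ y ∷ z ∷ [])
      x-y+z≉z : ¬ (x - y + z) ≋ z
      x-y+z≉z = ≉-by-difference x≉y difference
        where difference : x - y ≡ (x - y + z) - z
              difference = solve (x ∷ y ∷ z ∷ [])

      distinct : Unique corners
      distinct = ((λ ()) ∷ apart 0≉x-y ∷ (λ ()) ∷ apart 0≉z-y ∷ (λ ()) ∷ [])
               ∷ ((λ ()) ∷ apart x≉x-y+z ∷ (λ ()) ∷ apart x≉z ∷ [])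
               ∷ ((λ ()) ∷ apart x-y≉z-y ∷ (λ ()) ∷ [])
               ∷ ((λ ()) ∷ apart x-y+z≉z ∷ [])
               ∷ ((λ ()) ∷ [])
               ∷ [] ∷ []
        where open VecAll using (_∷_; [])
              open VecAllPairs using (_∷_; [])

    girth-six : ∀ {x y z} → ¬ x ≋ y → ¬ x ≋ z → ¬ y ≋ z → Sidon (x ∷ y ∷ z ∷ []) →
                Girth≡ (HaarAdj n (x ∷ y ∷ z ∷ [])) 6
    girth-six x≉y x≉z y≉z sidon = hexagon x≉y x≉z y≉z , no-short-cycles sidon

-- The pairwise incongruent entries 0, a, b of the first list
-- give the hexagon; the incongruent pairs (a, -a), (0, 2b), (0, 2b - 2a),
-- (0, b + a), (0, b - 2a) and (0, 2b - a) of the two lists give the Sidon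
-- property of {0, a, b}.
corollary7 : (n a b : ℕ) → 0 < n → 0 < a → a < b →
    DistinctMod n
      ((+ 0) ∷ (+ a) ∷ (+ b) ∷ ((+ 2) * (+ b)) ∷ ((+ b) + (+ a)) ∷ ((+ b) - (+ a))
        ∷ (((+ 2) * (+ b)) - (+ a)) ∷ (((+ 2) * (+ b)) - ((+ 2) * (+ a)))
        ∷ (((+ 3) * (+ b)) - (+ a)) ∷ (((+ 3) * (+ b)) - ((+ 2) * (+ a)))
        ∷ (((+ 2) * (+ b)) + (+ a)) ∷ ((+ 3) * (+ b)) ∷ []) →
    DistinctMod n
      ((+ 0) ∷ (+ a) ∷ (+ b) ∷ ((+ 2) * (+ b)) ∷ ((+ b) + (+ a)) ∷ ((+ b) - (+ a))
        ∷ (((+ 2) * (+ b)) - (+ a)) ∷ (((+ 2) * (+ b)) - ((+ 2) * (+ a)))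
        ∷ (((+ 3) * (+ b)) - (+ a)) ∷ (((+ 3) * (+ b)) - ((+ 2) * (+ a)))
        ∷ (- (+ a)) ∷ ((+ b) - ((+ 2) * (+ a))) ∷ []) →
    Girth≡ (HaarAdj n ((+ 0) ∷ (+ a) ∷ (+ b) ∷ [])) 6
corollary7 n a b 0<n _ _ L₁ L₂ =
  girth-six {{>-nonZero 0<n}}
    (entries-apart L₁ 0F 1F z<s)
    (entries-apart L₁ 0F 2F z<s)
    (entries-apart L₁ 1F 2F (s<s z<s))
    (Sidon-0ab (entries-apart L₂ 1F (# 10) (s<s z<s))
               (entries-apart L₁ 0F 3F z<s)
               (entries-apart L₁ 0F 7F z<s)
               (entries-apart L₁ 0F 4F z<s)
               (entries-apart L₂ 0F (# 11) z<s)
               (entries-apart L₁ 0F 6F z<s))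
  where
  open Modulo n
  open HaarGraph n
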